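{- The logic {\bf CNL$^2_4$} is Post complete: for every formula $A$ such that $A$ is not a theorem of {\bf CNL$^2_4$}, the extension of {\bf CNL$^2_4$} by $A$ is trivial, i.e., every formula $B$ is derivable in it.
   Context: Formulas are built from a countable set of propositional variables using ${\sim}$ (unary) and $\wedge,\vee$ (binary). A {\bf CNL$^2_4$}-interpretation assigns each variable a value in $\{\mathbf{1},\mathbf{i},\mathbf{j},\mathbf{0}\}$ and is extended to all formulas by the truth tables: ${\sim}\mathbf{1}=\mathbf{i}$, ${\sim}\mathbf{i}=\mathbf{0}$, ${\sim}\mathbf{j}=\mathbf{1}$, ${\sim}\mathbf{0}=\mathbf{j}$; $\wedge$: $\mathbf{1}\wedge x=x\wedge\mathbf{1}=x$, $\mathbf{0}\wedge x=x\wedge\mathbf{0}=\mathbf{0}$, $\mathbf{i}\wedge\mathbf{i}=\mathbf{i}$, $\mathbf{j}\wedge\mathbf{j}=\mathbf{j}$, $\mathbf{i}\wedge\mathbf{j}=\mathbf{j}\wedge\mathbf{i}=\mathbf{0}$; $\vee$: $\mathbf{1}\vee x=x\vee\mathbf{1}=\mathbf{1}$, $\mathbf{0}\vee x=x\vee\mathbf{0}=x$, $\mathbf{i}\vee\mathbf{i}=\mathbf{i}$, $\mathbf{j}\vee\mathbf{j}=\mathbf{j}$, $\mathbf{i}\vee\mathbf{j}=\mathbf{j}\vee\mathbf{i}=\mathbf{1}$. The consequence relation of {\bf CNL$^2_4$}: $\Gamma\models A$ iff for every interpretation, if every $B\in\Gamma$ takes a value in $\mathcal{D}=\{\mathbf{1},\mathbf{i}\}$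 then $A$ takes a value in $\mathcal{D}$; $A$ is a theorem iff $\emptyset\models A$. The extension of the logic by $A$ is the (structural) consequence relation obtained by adding $A$ as an axiom, i.e. all substitution instances of $A$ become theorems. -}

module Defs where

open import Data.Nat using (ℕ)
open import Data.Empty using (⊥)

data Formula : Set where
  var  : ℕ → Formula
  ∼_   : Formula → Formula
  _∧_  : Formula → Formula → Formula
  _∨_  : Formula → Formula → Formula

infixr 6 _∧_
infixr 5 _∨_
infix  7 ∼_

data V : Set where
  𝟏 𝐢 𝐣 𝟎 : V

neg : V → V
neg 𝟏 = 𝐢
neg 𝐢 = 𝟎
neg 𝐣 = 𝟏
neg 𝟎 = 𝐣

conj : V → V → V
conj 𝟏 x = x
conj 𝟎 x = 𝟎
conj 𝐢 𝟏 = 𝐢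
conj 𝐢 𝐢 = 𝐢
conj 𝐢 𝐣 = 𝟎
conj 𝐢 𝟎 = 𝟎
conj 𝐣 𝟏 = 𝐣
conj 𝐣 𝐢 = 𝟎
conj 𝐣 𝐣 = 𝐣
conj 𝐣 𝟎 = 𝟎

disj : V → V → V
disj 𝟏 x = 𝟏
disj 𝟎 x = x
disj 𝐢 𝟏 = 𝟏
disj 𝐢 𝐢 = 𝐢
disj 𝐢 𝐣 = 𝟏
disj 𝐢 𝟎 = 𝐢
disj 𝐣 𝟏 = 𝟏
disj 𝐣 𝐢 = 𝟏
disj 𝐣 𝐣 = 𝐣
disj 𝐣 𝟎 = 𝐣

Interpretation : Set
Interpretation = ℕ → V

eval : Interpretation → Formula → V
eval v (var n)  = v n
eval v (∼ A)    = neg (eval v A)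
eval v (A ∧ B)  = conj (eval v A) (eval v B)
eval v (A ∨ B)  = disj (eval v A) (eval v B)

data Designated : V → Set where
  des-𝟏 : Designated 𝟏
  des-𝐢 : Designated 𝐢

FSet : Set₁
FSet = Formula → Set

∅ : FSet
∅ _ = ⊥

_⊨_ : FSet → Formula → Set
Γ ⊨ A = (v : Interpretation) → (∀ B → Γ B → Designated (eval v B)) → Designated (eval v A)

Theorem : Formula → Set
Theorem A = ∅ ⊨ A

Subst : Set
Subst = ℕ → Formula

_[_] : Formula → Subst → Formula
var n   [ σ ] = σ n
(∼ A)   [ σ ] = ∼ (A [ σ ])
(A ∧ B) [ σ ] = (A [ σ ]) ∧ (B [ σ ])
(A ∨ B) [ σ ] = (A [ σ ]) ∨ (B [ σ ])

-- The extension of CNL²₄ by the axiom A: the least consequence relation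
-- containing ⊨ (all CNL²₄-valid inferences, with arbitrary premise sets),
-- the hypotheses, and all substitution instances of A as theorems.
data _⊢[_]_ (Γ : FSet) (A : Formula) : Formula → Set₁ where
  hyp   : ∀ {B} → Γ B → Γ ⊢[ A ] B
  axiom : (σ : Subst) → Γ ⊢[ A ] (A [ σ ])
  rule  : ∀ {B} (Δ : FSet) → Δ ⊨ B → (∀ C → Δ C → Γ ⊢[ A ] C) → Γ ⊢[ A ] B

Trivial : Formula → Set₁
Trivial A = ∀ B → ∅ ⊢[ A ] B

{-# OPTIONS --safe #-}
module Submission where

-- Negation permutes the four values cyclically (1 ↦ i ↦ 0 ↦ j ↦ 1), so under
-- any interpretation v the formulas ∼ⁿ p₀ take every value. Hence if A is
-- refuted by some w, substituting for each variable x a formula ∼ⁿ p₀ whose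
-- value under v is w x yields an instance of A that v refutes. No
-- interpretation designates all instances of A, so they entail every formula.

open import Defs
open import Relation.Nullary using (¬_)
open import Data.Nat using (ℕ; zero; suc; _+_)
open import Data.Nat.GeneralisedArithmetic using (fold; fold-+)
open import Data.Empty using (⊥-elim)
open import Data.Product using (Σ-syntax; ∃-syntax; _,_; proj₁; proj₂)
open import Relation.Binary.PropositionalEquality
  using (_≡_; refl; trans; cong; cong₂; subst; module ≡-Reasoning)

neg-from-𝟏 : ∀ b → ∃[ n ] fold 𝟏 neg n ≡ b
neg-from-𝟏 𝟏 = 0 , refl
neg-from-𝟏 𝐢 = 1 , refl
neg-from-𝟏 𝟎 = 2 , refl
neg-from-𝟏 𝐣 = 3 , refl

neg-to-𝟏 : ∀ a → ∃[ n ] fold a neg n ≡ 𝟏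
neg-to-𝟏 𝟏 = 0 , refl
neg-to-𝟏 𝐢 = 3 , refl
neg-to-𝟏 𝟎 = 2 , refl
neg-to-𝟏 𝐣 = 1 , refl

neg-reaches : ∀ a b → ∃[ n ] fold a neg n ≡ b
neg-reaches a b = m + n , (begin
  fold a neg (m + n)           ≡⟨ fold-+ a neg m ⟩
  fold (fold a neg n) neg m    ≡⟨ cong (λ x → fold x neg m) a↝𝟏 ⟩
  fold 𝟏 neg m                 ≡⟨ 𝟏↝b ⟩
  b                            ∎)
  where
  open ≡-Reasoning
  n = proj₁ (neg-to-𝟏 a)
  a↝𝟏 = proj₂ (neg-to-𝟏 a)
  m = proj₁ (neg-from-𝟏 b)
  𝟏↝b = proj₂ (neg-from-𝟏 b)

eval-fold-∼ : ∀ (v : Interpretation) A n → eval v (fold A ∼_ n) ≡ fold (eval v A) neg n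
eval-fold-∼ v A zero    = refl
eval-fold-∼ v A (suc n) = cong neg (eval-fold-∼ v A n)

eval-subst : ∀ (v w : Interpretation) (σ : Subst) → (∀ x → eval v (σ x) ≡ w x) →
             ∀ A → eval v (A [ σ ]) ≡ eval w A
eval-subst v w σ σ≗w (var x) = σ≗w x
eval-subst v w σ σ≗w (∼ A)   = cong neg (eval-subst v w σ σ≗w A)
eval-subst v w σ σ≗w (A ∧ B) = cong₂ conj (eval-subst v w σ σ≗w A) (eval-subst v w σ σ≗w B)
eval-subst v w σ σ≗w (A ∨ B) = cong₂ disj (eval-subst v w σ σ≗w A) (eval-subst v w σ σ≗w B)

realising-subst : ∀ (v w : Interpretation) → Σ[ σ ∈ Subst ] (∀ x → eval v (σ x) ≡ w x)
realising-subst v w = σ , σ≗w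
  where
  steps : ℕ → ℕ
  steps x = proj₁ (neg-reaches (v 0) (w x))

  σ : Subst
  σ x = fold (var 0) ∼_ (steps x)

  σ≗w : ∀ x → eval v (σ x) ≡ w x
  σ≗w x = trans (eval-fold-∼ v (var 0) (steps x)) (proj₂ (neg-reaches (v 0) (w x)))

instances-designated⇒theorem : ∀ A (v : Interpretation) → (∀ σ → Designated (eval v (A [ σ ]))) → Theorem A
instances-designated⇒theorem A v designated w _ =
  subst Designated (eval-subst v w σ σ≗w A) (designated σ)
  where
  σ = proj₁ (realising-subst v w)
  σ≗w = proj₂ (realising-subst v w)

Instance : Formula → FSet
Instance A C = ∃[ σ ] C ≡ A [ σ ]

instance-derivable : ∀ {Γ A C} → Instance A C → Γ ⊢[ A ] C
instance-derivable (σ , refl) = axiom σ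

mainTheorem4 : ∀ (A : Formula) → ¬ Theorem A → Trivial A
mainTheorem4 A ¬thm B = rule (Instance A) instances⊨B (λ _ → instance-derivable)
  where
  instances⊨B : Instance A ⊨ B
  instances⊨B v designated =
    ⊥-elim (¬thm (instances-designated⇒theorem A v (λ σ → designated (A [ σ ]) (σ , refl))))
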